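{- There are infinitely many integers $t$ such that $t-4$, $t-2$ and $t$ all belong to $\mathcal{D}$ (i.e. $\mathcal{D}$ contains infinitely many triplets).
   Context: Let $\mathcal{D}$ (OEIS A036991) be the set of positive integers $m$ such that, in the binary expansion of $m$ written without leading zeros, every suffix contains at least as many digits $1$ as digits $0$. A triplet of $\mathcal{D}$ is a triple $(t-4, t-2, t)$ of integers all belonging to $\mathcal{D}$. -}

module Defs where

open import Data.Nat using (ℕ; zero; suc; _+_; _≤_; _<_; _∸_)
open import Data.Nat.DivMod using (_/_; _%_)
open import Data.List using (List; []; _∷_; take; length)
open import Data.Product using (_×_)
open import Relation.Binary.PropositionalEquality using (_≡_)

-- Binary digits of m, least significant digit first, without leading zeros
-- (so bits 0 = []).  Fuel argument f ≥ m guarantees termination.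
bitsFuel : ℕ → ℕ → List ℕ
bitsFuel zero    m       = []
bitsFuel (suc f) zero    = []
bitsFuel (suc f) (suc m) = (suc m % 2) ∷ bitsFuel f (suc m / 2)

bits : ℕ → List ℕ
bits m = bitsFuel m m

ones : List ℕ → ℕ
ones []       = 0
ones (1 ∷ xs) = suc (ones xs)
ones (_ ∷ xs) = ones xs

zeros : List ℕ → ℕ
zeros []       = 0
zeros (0 ∷ xs) = suc (zeros xs)
zeros (_ ∷ xs) = zeros xs

-- Since bits is least-significant-first, the suffixes of the usual
-- (most-significant-first) binary word are exactly the lists  take k (bits m).
-- 𝒟 (OEIS A036991): positive m such that every suffix of its binary
-- expansion has at least as many 1s as 0s.
InD : ℕ → Set
InD m = (0 < m) × ((k : ℕ) → k ≤ length (bits m) →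
                     zeros (take k (bits m)) ≤ ones (take k (bits m)))

-- (t-4, t-2, t) is a triplet of 𝒟 (t ≥ 4 so that t-4 is a natural number;
-- it is forced anyway since elements of 𝒟 are positive)
Triplet : ℕ → Set
Triplet t = (4 ≤ t) × InD (t ∸ 4) × InD (t ∸ 2) × InD t

{-# OPTIONS --safe #-}
module Submission where

-- If m ∈ 𝒟, the binary words of 8m+3, 8m+5 and 8m+7 are those of m followed
-- by 011, 101 and 111; appending any of these three blocks to a word whose
-- suffixes are all 1-dominated keeps that property, so (8m+3, 8m+5, 8m+7) is
-- a triplet.  In particular 8m+7 ∈ 𝒟 again, and iterating m ↦ 8m+7 from
-- m = 1 yields arbitrarily large triplets.

open import Defs
open import Data.Nat using (ℕ; zero; suc; _+_; _*_; _∸_; _≤_; _<_; z≤n; s≤s; _/_; _%_)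
open import Data.Nat.Properties
  using (≤-refl; ≤-trans; ≤-<-trans; <⇒≤; m≤n⇒m≤1+n; m≤n+m; m<m+n; m≤n*m; m+n∸n≡m; +-identityʳ; <⇒≤pred; ≤-total)
open import Data.Nat.DivMod
  using (m/n<m; m<n⇒m%n≡m; m<n⇒m/n≡0; [m+kn]%n≡m%n; +-distrib-/; m*n%n≡0; m*n/n≡m)
open import Data.Nat.Tactic.RingSolver using (solve-∀)
open import Data.List using (List; []; _∷_; take; length)
open import Data.List.Properties using (take-all)
open import Data.Product using (Σ; _×_; _,_; proj₂)
open import Data.Sum using (inj₁; inj₂)
open import Relation.Binary.PropositionalEquality
  using (_≡_; refl; sym; trans; cong; cong₂; subst; module ≡-Reasoning)

bitsFuel-irrelevant : ∀ f g m → m ≤ f → m ≤ g → bitsFuel f m ≡ bitsFuel g m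
bitsFuel-irrelevant zero    zero    zero    _ _ = refl
bitsFuel-irrelevant zero    (suc g) zero    _ _ = refl
bitsFuel-irrelevant (suc f) zero    zero    _ _ = refl
bitsFuel-irrelevant (suc f) (suc g) zero    _ _ = refl
bitsFuel-irrelevant (suc f) (suc g) (suc m) (s≤s m≤f) (s≤s m≤g) =
  cong (suc m % 2 ∷_)
       (bitsFuel-irrelevant f g (suc m / 2) (≤-trans half≤m m≤f) (≤-trans half≤m m≤g))
  where
  half≤m : suc m / 2 ≤ m
  half≤m with m/n<m (suc m) 2 (s≤s (s≤s z≤n))
  ... | s≤s le = le

bits-positive : ∀ {m} → 0 < m → bits m ≡ m % 2 ∷ bits (m / 2)
bits-positive {suc m} _ = cong (suc m % 2 ∷_)
  (bitsFuel-irrelevant m (suc m / 2) (suc m / 2) (<⇒≤pred (m/n<m (suc m) 2 (s≤s (s≤s z≤n)))) ≤-refl)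

[b+m*2]%2≡b : ∀ b m → b < 2 → (b + m * 2) % 2 ≡ b
[b+m*2]%2≡b b m b<2 = trans ([m+kn]%n≡m%n b m 2) (m<n⇒m%n≡m b<2)

[b+m*2]/2≡m : ∀ b m → b < 2 → (b + m * 2) / 2 ≡ m
[b+m*2]/2≡m b m b<2 = begin
  (b + m * 2) / 2     ≡⟨ +-distrib-/ b (m * 2) remainders<2 ⟩
  b / 2 + m * 2 / 2   ≡⟨ cong₂ _+_ (m<n⇒m/n≡0 b<2) (m*n/n≡m m 2) ⟩
  m                   ∎
  where
  open ≡-Reasoning
  remainders<2 : b % 2 + m * 2 % 2 < 2
  remainders<2 = subst (_< 2) (sym (trans (cong₂ _+_ (m<n⇒m%n≡m b<2) (m*n%n≡0 m 2)) (+-identityʳ b))) b<2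

bits-digit : ∀ b m → b < 2 → 0 < b + m * 2 → bits (b + m * 2) ≡ b ∷ bits m
bits-digit b m b<2 pos =
  trans (bits-positive pos) (cong₂ _∷_ ([b+m*2]%2≡b b m b<2) (cong bits ([b+m*2]/2≡m b m b<2)))

bits-1+m*2 : ∀ m → bits (1 + m * 2) ≡ 1 ∷ bits m
bits-1+m*2 m = bits-digit 1 m (s≤s (s≤s z≤n)) (s≤s z≤n)

bits-m*2 : ∀ {m} → 0 < m → bits (m * 2) ≡ 0 ∷ bits m
bits-m*2 {suc m} _ = bits-digit 0 (suc m) (s≤s z≤n) (s≤s z≤n)

Ballot : List ℕ → Set
Ballot l = ∀ k → zeros (take k l) ≤ ones (take k l)

ballot-[] : Ballot []
ballot-[] zero    = z≤n
ballot-[] (suc k) = z≤n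

ballot-1∷ : ∀ {l} → Ballot l → Ballot (1 ∷ l)
ballot-1∷ ballot zero    = z≤n
ballot-1∷ ballot (suc k) = m≤n⇒m≤1+n (ballot k)

ballot-1∷0∷ : ∀ {l} → Ballot l → Ballot (1 ∷ 0 ∷ l)
ballot-1∷0∷ ballot zero          = z≤n
ballot-1∷0∷ ballot (suc zero)    = z≤n
ballot-1∷0∷ ballot (suc (suc k)) = s≤s (ballot k)

InD⇒Ballot : ∀ {m} → InD m → Ballot (bits m)
InD⇒Ballot {m} (_ , dominated) k with ≤-total k (length (bits m))
... | inj₁ k≤len = dominated k k≤len
... | inj₂ len≤k = subst OnesDominate (sym (take-all k (bits m) len≤k)) whole
  where
  OnesDominate : List ℕ → Set
  OnesDominate l = zeros l ≤ ones l
  whole : OnesDominate (bits m)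
  whole = subst OnesDominate (take-all _ (bits m) ≤-refl) (dominated _ ≤-refl)

Ballot⇒InD : ∀ {m} → 0 < m → Ballot (bits m) → InD m
Ballot⇒InD pos ballot = pos , λ k _ → ballot k

m≡n+o⇒m∸o≡n : ∀ {m n o} → m ≡ n + o → m ∸ o ≡ n
m≡n+o⇒m∸o≡n {n = n} {o} refl = m+n∸n≡m n o

8m+7-binary : ∀ m → 8 * m + 7 ≡ 1 + (1 + (1 + m * 2) * 2) * 2
8m+7-binary = solve-∀

8m+5-binary : ∀ m → 8 * m + 7 ≡ 1 + ((1 + m * 2) * 2) * 2 + 2
8m+5-binary = solve-∀

8m+3-binary : ∀ m → 8 * m + 7 ≡ 1 + (1 + (m * 2) * 2) * 2 + 4
8m+3-binary = solve-∀

InD⇒Triplet[8m+7] : ∀ {m} → InD m → Triplet (8 * m + 7)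
InD⇒Triplet[8m+7] {m} m∈D@(m>0 , _) =
  ≤-trans (s≤s (s≤s (s≤s (s≤s z≤n)))) (m≤n+m 7 (8 * m)) ,
  inD (m≡n+o⇒m∸o≡n (8m+3-binary m))
      (ballot-1∷ (ballot-1∷0∷ ballot))
      (trans (bits-1+m*2 _) (cong (1 ∷_) (bits-m*2 m>0))) ,
  inD (m≡n+o⇒m∸o≡n (8m+5-binary m))
      (ballot-1∷0∷ (ballot-1∷ ballot))
      (trans (bits-m*2 (s≤s z≤n)) (cong (0 ∷_) (bits-1+m*2 m))) ,
  inD (8m+7-binary m)
      (ballot-1∷ (ballot-1∷ (ballot-1∷ ballot)))
      (trans (bits-1+m*2 _) (cong (1 ∷_) (bits-1+m*2 m)))
  where
  ballot : Ballot (bits m)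
  ballot = InD⇒Ballot m∈D
  inD : ∀ {t n l} → t ≡ 1 + n * 2 → Ballot (1 ∷ l) → bits n ≡ l → InD t
  inD refl ballot-l eq =
    Ballot⇒InD (s≤s z≤n) (subst Ballot (sym (trans (bits-1+m*2 _) (cong (1 ∷_) eq))) ballot-l)

orbit : ℕ → ℕ
orbit zero    = 1
orbit (suc n) = 8 * orbit n + 7

InD-orbit : ∀ n → InD (orbit n)
InD-orbit zero    = Ballot⇒InD (s≤s z≤n) (ballot-1∷ ballot-[])
InD-orbit (suc n) = proj₂ (proj₂ (proj₂ (InD⇒Triplet[8m+7] (InD-orbit n))))

orbit<orbit-suc : ∀ n → orbit n < orbit (suc n)
orbit<orbit-suc n = ≤-<-trans (m≤n*m (orbit n) 8) (m<m+n (8 * orbit n) (s≤s z≤n))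

n≤orbit : ∀ n → n ≤ orbit n
n≤orbit zero    = z≤n
n≤orbit (suc n) = ≤-<-trans (n≤orbit n) (orbit<orbit-suc n)

proposition4 : (N : ℕ) → Σ ℕ (λ t → N ≤ t × Triplet t)
proposition4 N =
  orbit (suc N) , <⇒≤ (n≤orbit (suc N)) , InD⇒Triplet[8m+7] (InD-orbit N)
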